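{- A language $\mathcal{L}\subseteq V^+$ over a finite alphabet $V$ is recognised by some $\mathbf{L}(/\to)$-grammar whose assigned types all lie in $Tp_1(/)$ if and only if $\mathcal{L}$ is generated by some (right-)regular grammar.
   Context: A (right-)regular grammar is $(N,\Sigma,S,P)$ with finite non-terminals $N$, terminals $\Sigma$, start symbol $S\in N$ and a finite set $P$ of productions each of the form $A\to aB$ or $A\to a$ ($A,B\in N$, $a\in\Sigma$). Fix a finite set $Pr$ of primitive types; $Tp_1(/)$ is the set of types of the form $A$ or $A/B$ with $A,B\in Pr$. Sequents are $\Gamma\to\alpha$ with $\Gamma$ a non-empty finite sequence of types. $\mathbf{L}(/\to)$ has Axiom $\alpha\to\alpha$; Cut: from $\Gamma,\alpha,\Theta\to\beta$ and $\Delta\to\alpha$ infer $\Gamma,\Delta,\Theta\to\beta$; and $(/\to)$: from $\Gamma\to\alpha$ and $\Delta,\beta,\Theta\to\gamma$ infer $\Delta,(\beta/\alpha),\Gamma,\Theta\to\gamma$. An $\mathbf{L}(/\to)$-grammar is $(Pr,V,S_{\mathcal G},f)$ with $S_{\mathcal G}\in Pr$ and $f$ assigning to each $a\in V$ a finite set of types; it recognises $w=a_1\cdots a_n\in V^+$ iff there are $\alpha_k\in f(a_k)$ with $\mathbf{L}(/\to)\vdash\alpha_1,\dots,\alpha_n\to S_{\mathcal G}$. -}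

module Defs where

open import Data.Nat using (ℕ)
open import Data.Fin using (Fin)
open import Data.List using (List; []; _∷_; _++_; [_])
open import Data.List.NonEmpty using (List⁺; _∷_; toList)
open import Data.List.Membership.Propositional using (_∈_)
open import Data.List.Relation.Unary.All using (All)
open import Data.List.Relation.Binary.Pointwise using (Pointwise)
open import Data.Product using (Σ; _×_)

infixl 7 _/_
data Tp (Pr : Set) : Set where
  prim : Pr → Tp Pr
  _/_  : Tp Pr → Tp Pr → Tp Pr

data InTp1 {Pr : Set} : Tp Pr → Set where
  tp-prim  : (A : Pr) → InTp1 (prim A)
  tp-slash : (A B : Pr) → InTp1 (prim A / prim B)

-- The calculus L(/→).  Antecedents are lists; every derivable
-- antecedent is automatically non-empty (axioms are non-empty and the
-- rules only enlarge antecedents).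

infix 4 _⊢_
data _⊢_ {Pr : Set} : List (Tp Pr) → Tp Pr → Set where
  ax   : ∀ {α} → [ α ] ⊢ α
  cut  : ∀ {Γ Δ Θ α β} →
         Γ ++ α ∷ Θ ⊢ β → Δ ⊢ α → Γ ++ Δ ++ Θ ⊢ β
  /→   : ∀ {Γ Δ Θ α β γ} →
         Γ ⊢ α → Δ ++ β ∷ Θ ⊢ γ → Δ ++ (β / α) ∷ Γ ++ Θ ⊢ γ

record LGrammar (V : Set) : Set where
  field
    nPr   : ℕ
    start : Fin nPr
    f     : V → List (Tp (Fin nPr))

open LGrammar public

AllTp1 : {V : Set} → LGrammar V → Set
AllTp1 {V} G = (a : V) → All InTp1 (f G a)

Recognises : {V : Set} → LGrammar V → List⁺ V → Set
Recognises G w =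
  Σ (List (Tp (Fin (nPr G)))) λ αs →
    Pointwise (λ a α → α ∈ f G a) (toList w) αs × (αs ⊢ prim (start G))

data Production (N V : Set) : Set where
  _⟶_·_ : N → V → N → Production N V
  _⟶_   : N → V → Production N V

record RegGrammar (V : Set) : Set where
  field
    nN     : ℕ
    startN : Fin nN
    P      : List (Production (Fin nN) V)

open RegGrammar public

data Derives {V : Set} (R : RegGrammar V) : Fin (nN R) → List⁺ V → Set where
  end  : ∀ {A a} → (A ⟶ a) ∈ P R → Derives R A (a ∷ [])
  step : ∀ {A a B w} → (A ⟶ a · B) ∈ P R → Derives R B w →
         Derives R A (a ∷ toList w)

Generates : {V : Set} → RegGrammar V → List⁺ V → Set
Generates R w = Derives R (startN R) w

-- Interpret each primitive A as the set of "chains" A/B₁, B₁/B₂, …, Bₙ₋₁/Bₙ, Bₙ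
-- (lists of types) and β/α as the residual {u | u·v ∈ ⟦β⟧ for all v ∈ ⟦α⟧}.  L(/→) is
-- sound for every such language model, and a sequence of Tp₁(/) types denotes
-- itself, so it derives A exactly when it is a chain from A.  A chain of lexical
-- types is a derivation in the regular grammar with A → aB for A/B ∈ f(a) and
-- A → a for A ∈ f(a); this dictionary between productions and Tp₁(/) types is a
-- bijection, which gives both directions.
module Submission where

open import Defs
open import Data.Nat using (ℕ)
open import Data.Fin using (Fin)
import Data.Fin.Properties as Fin
open import Data.List using (List; []; _∷_; _++_; [_]; map; filter; concatMap; allFin)
open import Data.List.NonEmpty using (List⁺; _∷_; toList)
open import Data.List.Membership.Propositional using (_∈_; find; lose)
open import Data.List.Membership.Propositional.Properties
  using (∈-concatMap⁺; ∈-concatMap⁻; ∈-allFin; ∈-map∘filter⁺; ∈-map∘filter⁻)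
open import Data.List.Relation.Unary.All using (All; []; _∷_; lookup; universal)
open import Data.List.Relation.Unary.All.Properties using (map⁺)
open import Data.List.Relation.Unary.Any using (here)
open import Data.List.Relation.Binary.Pointwise using (Pointwise; []; _∷_)
open import Data.List.Properties using (++-assoc; ++-identityʳ)
open import Data.Product using (Σ; ∃; _×_; _,_)
open import Relation.Binary.Definitions using (DecidableEquality)
open import Relation.Binary.PropositionalEquality using (_≡_; refl; sym; subst; cong)
open import Function using (_⇔_; mk⇔; Equivalence)
open import Function.Construct.Composition using (_⇔-∘_)
open import Function.Construct.Symmetry using (⇔-sym)

module LanguageModel {Pr X : Set} (⟦_⟧ᵖ : Pr → List X → Set) where

  ⟦_⟧ : Tp Pr → List X → Set
  ⟦ prim A ⟧ w = ⟦ A ⟧ᵖ w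
  ⟦ β / α ⟧ w = ∀ v → ⟦ α ⟧ v → ⟦ β ⟧ (w ++ v)

  ⟦_⟧* : List (Tp Pr) → List X → Set
  ⟦ [] ⟧* w = w ≡ []
  ⟦ α ∷ Γ ⟧* w = Σ (List X) λ u → Σ (List X) λ v → w ≡ u ++ v × ⟦ α ⟧ u × ⟦ Γ ⟧* v

  ⟦++⟧*⁻ : ∀ Γ Δ w → ⟦ Γ ++ Δ ⟧* w →
           Σ (List X) λ u → Σ (List X) λ v → w ≡ u ++ v × ⟦ Γ ⟧* u × ⟦ Δ ⟧* v
  ⟦++⟧*⁻ [] Δ w h = [] , w , refl , refl , h
  ⟦++⟧*⁻ (α ∷ Γ) Δ w (u , v , refl , a , h) with ⟦++⟧*⁻ Γ Δ v h
  ... | u′ , v′ , refl , g , d =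
    u ++ u′ , v′ , sym (++-assoc u u′ v′) , (u , u′ , refl , a , g) , d

  ⟦++⟧*⁺ : ∀ Γ Δ {u v} → ⟦ Γ ⟧* u → ⟦ Δ ⟧* v → ⟦ Γ ++ Δ ⟧* (u ++ v)
  ⟦++⟧*⁺ [] Δ refl d = d
  ⟦++⟧*⁺ (α ∷ Γ) Δ {v = v} (x , y , refl , a , g) d =
    x , y ++ v , ++-assoc x y v , a , ⟦++⟧*⁺ Γ Δ g d

  ⊢-sound : ∀ {Γ γ} → Γ ⊢ γ → ∀ w → ⟦ Γ ⟧* w → ⟦ γ ⟧ w
  ⊢-sound {γ = γ} ax w (u , v , refl , a , refl) = subst ⟦ γ ⟧ (sym (++-identityʳ u)) a
  ⊢-sound (cut {Γ} {Δ} {Θ} {α} d e) w h with ⟦++⟧*⁻ Γ (Δ ++ Θ) w h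
  ... | g , r , refl , hg , hr with ⟦++⟧*⁻ Δ Θ r hr
  ... | x , t , refl , hx , ht =
    ⊢-sound d _ (⟦++⟧*⁺ Γ (α ∷ Θ) hg (x , t , refl , ⊢-sound e x hx , ht))
  ⊢-sound {γ = γ} (/→ {Γ} {Δ} {Θ} {α} {β} d e) w h with ⟦++⟧*⁻ Δ ((β / α) ∷ Γ ++ Θ) w h
  ... | x , r , refl , hx , (u , r′ , refl , hu , hr′) with ⟦++⟧*⁻ Γ Θ r′ hr′
  ... | g , t , refl , hg , ht =
    subst ⟦ γ ⟧ (cong (x ++_) (++-assoc u g t))
      (⊢-sound e _ (⟦++⟧*⁺ Δ (β ∷ Θ) hx (u ++ g , t , refl , hu g (⊢-sound d g hg) , ht)))

module _ {Pr : Set} where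

  data Chain : Pr → List (Tp Pr) → Set where
    end  : ∀ {A} → Chain A [ prim A ]
    step : ∀ {A B αs} → Chain B αs → Chain A ((prim A / prim B) ∷ αs)

  open LanguageModel Chain

  ⟦InTp1⟧ : ∀ {α} → InTp1 α → ⟦ α ⟧ [ α ]
  ⟦InTp1⟧ (tp-prim A) = end
  ⟦InTp1⟧ (tp-slash A B) v c = step c

  ⟦All-InTp1⟧ : ∀ {αs} → All InTp1 αs → ⟦ αs ⟧* αs
  ⟦All-InTp1⟧ [] = refl
  ⟦All-InTp1⟧ {α ∷ αs} (p ∷ ps) = [ α ] , αs , refl , ⟦InTp1⟧ p , ⟦All-InTp1⟧ ps

  chain⇒⊢ : ∀ {A αs} → Chain A αs → αs ⊢ prim A
  chain⇒⊢ end = ax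
  chain⇒⊢ (step {A} {B} {αs} c) =
    subst (λ Γ → (prim A / prim B) ∷ Γ ⊢ prim A) (++-identityʳ αs)
      (/→ {Δ = []} {Θ = []} (chain⇒⊢ c) ax)

  ⊢⇒chain : ∀ {A αs} → All InTp1 αs → αs ⊢ prim A → Chain A αs
  ⊢⇒chain ps d = ⊢-sound d _ (⟦All-InTp1⟧ ps)

module _ {N V : Set} where

  letter : Production N V → V
  letter (A ⟶ a · B) = a
  letter (A ⟶ a)     = a

  typeOf : Production N V → Tp N
  typeOf (A ⟶ a · B) = prim A / prim B
  typeOf (A ⟶ a)     = prim A

  typeOf-InTp1 : ∀ p → InTp1 (typeOf p)
  typeOf-InTp1 (A ⟶ a · B) = tp-slash A B
  typeOf-InTp1 (A ⟶ a)     = tp-prim A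

  letter-typeOf-injective : ∀ p q → letter p ≡ letter q → typeOf p ≡ typeOf q → p ≡ q
  letter-typeOf-injective (A ⟶ a · B) (.A ⟶ .a · .B) refl refl = refl
  letter-typeOf-injective (A ⟶ a)     (.A ⟶ .a)      refl refl = refl

Matches : {V : Set} (R : RegGrammar V) → (V → List (Tp (Fin (nN R)))) → Set
Matches R f = ∀ p → p ∈ P R ⇔ typeOf p ∈ f (letter p)

module Correspondence {V : Set} (R : RegGrammar V) (f : V → List (Tp (Fin (nN R))))
                      (matches : Matches R f) where

  Lexical : List V → List (Tp (Fin (nN R))) → Set
  Lexical = Pointwise (λ a α → α ∈ f a)

  derives⇒chain : ∀ {A w} → Derives R A w → ∃ λ αs → Lexical (toList w) αs × Chain A αs
  derives⇒chain (end {A} {a} p) = _ , (Equivalence.to (matches (A ⟶ a)) p ∷ []) , end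
  derives⇒chain (step {A} {a} {B} p d) with derives⇒chain d
  ... | αs , lex , c = _ , (Equivalence.to (matches (A ⟶ a · B)) p ∷ lex) , step c

  chain⇒derives : ∀ {A a as αs} → Lexical (a ∷ as) αs → Chain A αs → Derives R A (a ∷ as)
  chain⇒derives {A} {a} (m ∷ []) end = end (Equivalence.from (matches (A ⟶ a)) m)
  chain⇒derives (m ∷ []) (step ())
  chain⇒derives {A} {a} (m ∷ lex@(_ ∷ _)) (step {B = B} c) =
    step (Equivalence.from (matches (A ⟶ a · B)) m) (chain⇒derives lex c)

  grammar : LGrammar V
  grammar = record { nPr = nN R ; start = startN R ; f = f }

  generates⇔recognises : (∀ a → All InTp1 (f a)) → ∀ w → Generates R w ⇔ Recognises grammar w
  generates⇔recognises tp1 w = mk⇔ to from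
    where
    to : Generates R w → Recognises grammar w
    to d with derives⇒chain d
    ... | αs , lex , c = αs , lex , chain⇒⊢ c

    lexical-InTp1 : ∀ {as αs} → Lexical as αs → All InTp1 αs
    lexical-InTp1 [] = []
    lexical-InTp1 {a ∷ _} (m ∷ lex) = lookup (tp1 a) m ∷ lexical-InTp1 lex

    from : Recognises grammar w → Generates R w
    from (αs , lex , d) = chain⇒derives lex (⊢⇒chain (lexical-InTp1 lex) d)

module FromRegular {V : Set} (_≟_ : DecidableEquality V) (R : RegGrammar V) where

  typesOf : V → List (Tp (Fin (nN R)))
  typesOf a = map typeOf (filter (λ p → letter p ≟ a) (P R))

  typesOf-InTp1 : ∀ a → All InTp1 (typesOf a)
  typesOf-InTp1 a = map⁺ (universal typeOf-InTp1 _)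

  typesOf-matches : Matches R typesOf
  typesOf-matches p = mk⇔ to from
    where
    to : p ∈ P R → typeOf p ∈ typesOf (letter p)
    to p∈P = ∈-map∘filter⁺ typeOf (λ q → letter q ≟ letter p) (p , p∈P , refl , refl)

    from : typeOf p ∈ typesOf (letter p) → p ∈ P R
    from t∈ with ∈-map∘filter⁻ typeOf (λ q → letter q ≟ letter p) t∈
    ... | q , q∈P , tp≡tq , lq≡lp =
      subst (_∈ P R) (letter-typeOf-injective q p lq≡lp (sym tp≡tq)) q∈P

module FromLambek {k : ℕ} (G : LGrammar (Fin k)) where

  productionsOf : Fin k → Tp (Fin (nPr G)) → List (Production (Fin (nPr G)) (Fin k))
  productionsOf a (prim A)          = [ A ⟶ a ]
  productionsOf a (prim A / prim B) = [ A ⟶ a · B ]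
  productionsOf a _                 = []

  ∈-productionsOf⁻ : ∀ {a α p} → p ∈ productionsOf a α → letter p ≡ a × typeOf p ≡ α
  ∈-productionsOf⁻ {α = prim A}          (here refl) = refl , refl
  ∈-productionsOf⁻ {α = prim A / prim B} (here refl) = refl , refl

  productionsOf-typeOf : ∀ p → p ∈ productionsOf (letter p) (typeOf p)
  productionsOf-typeOf (A ⟶ a · B) = here refl
  productionsOf-typeOf (A ⟶ a)     = here refl

  regular : RegGrammar (Fin k)
  regular = record
    { nN     = nPr G
    ; startN = start G
    ; P      = concatMap (λ a → concatMap (productionsOf a) (f G a)) (allFin k)
    }

  regular-matches : Matches regular (f G)
  regular-matches p = mk⇔ to from
    where
    to : p ∈ P regular → typeOf p ∈ f G (letter p)
    to p∈ with find (∈-concatMap⁻ _ {xs = allFin k} p∈)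
    ... | a , _ , p∈a with find (∈-concatMap⁻ (productionsOf a) {xs = f G a} p∈a)
    ... | α , α∈ , p∈α with ∈-productionsOf⁻ p∈α
    ... | refl , refl = α∈

    from : typeOf p ∈ f G (letter p) → p ∈ P regular
    from t∈ = ∈-concatMap⁺ _ (lose (∈-allFin (letter p))
                                   (∈-concatMap⁺ _ (lose t∈ (productionsOf-typeOf p))))

Tp1Recognisable : {k : ℕ} → (List⁺ (Fin k) → Set) → Set
Tp1Recognisable {k} L =
  Σ (LGrammar (Fin k)) λ G → AllTp1 G × ((w : List⁺ (Fin k)) → L w ⇔ Recognises G w)

RegularlyGenerated : {k : ℕ} → (List⁺ (Fin k) → Set) → Set
RegularlyGenerated {k} L =
  Σ (RegGrammar (Fin k)) λ R → (w : List⁺ (Fin k)) → L w ⇔ Generates R w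

Tp1Recognisable⇒RegularlyGenerated : ∀ {k} {L : List⁺ (Fin k) → Set} →
                                     Tp1Recognisable L → RegularlyGenerated L
Tp1Recognisable⇒RegularlyGenerated (G , tp1 , L⇔G) =
  regular , λ w → ⇔-sym (generates⇔recognises tp1 w) ⇔-∘ L⇔G w
  where open FromLambek G
        open Correspondence regular (f G) regular-matches

RegularlyGenerated⇒Tp1Recognisable : ∀ {k} {L : List⁺ (Fin k) → Set} →
                                     RegularlyGenerated L → Tp1Recognisable L
RegularlyGenerated⇒Tp1Recognisable (R , L⇔R) =
  grammar , typesOf-InTp1 , λ w → generates⇔recognises typesOf-InTp1 w ⇔-∘ L⇔R w
  where open FromRegular Fin._≟_ R
        open Correspondence R typesOf typesOf-matches

corollary1 : (k : ℕ) (L : List⁺ (Fin k) → Set) →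
    (Σ (LGrammar (Fin k)) λ G → AllTp1 G × ((w : List⁺ (Fin k)) → L w ⇔ Recognises G w))
    ⇔ (Σ (RegGrammar (Fin k)) λ R → (w : List⁺ (Fin k)) → L w ⇔ Generates R w)
corollary1 k L = mk⇔ Tp1Recognisable⇒RegularlyGenerated RegularlyGenerated⇒Tp1Recognisable
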